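{- Define the numbers $a^n_{sj}, b^n_{sj}$ (for $n\ge1$, $1\le j\le n$), $\theta^n$ and $\phi^n$ (for $n\ge 2$) recursively as follows. - Base case: $a^1_{s1}=b^1_{s1}=1$. - For $n\ge 2$: $\theta^n=3a^{n-1}_{s,n-1}$. - $\phi^2=4$, and for $n>2$, $\phi^n=4\sum_{j=1}^{n-1}\left(\theta^n b^{n-1}_{sj}-3a^{n-1}_{sj}\right)$. - For $n\ge2$ and $j<n$: $a^n_{sj}=4a^{n-1}_{sj}$ and $b^n_{sj}=(1+\theta^n)b^{n-1}_{sj}$. - For $n\ge 2$: $a^n_{sn}=\phi^n$ and $b^n_{sn}=1$. Then for every $n\ge 3$, $\phi^n\ge 3(\phi^{n-1})^2$. -}

module Defs where

open import Data.Nat using (ℕ; zero; suc)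
open import Data.Integer using (ℤ; +_; _+_; _-_; _*_)
open import Data.Vec using (Vec; []; _∷_; _∷ʳ_; map; zipWith; last; foldr)
open import Data.Product using (_×_; _,_; proj₁; proj₂)

sumℤ : ∀ {k} → Vec ℤ k → ℤ
sumℤ = foldr _ _+_ (+ 0)

-- Level n = suc m of the recursion: the pair of vectors
--   ( (a^n_{s1}, …, a^n_{sn}) , (b^n_{s1}, …, b^n_{sn}) ).
-- θ^n and φ^n (n ≥ 2) are computed from level n-1.

thetaFrom : ∀ {k} → Vec ℤ (suc k) → ℤ
thetaFrom as = + 3 * last as

-- φ^n from level n-1 = suc m data (so n = suc (suc m)):
--   φ^2 = 4 ;  φ^n = 4 Σ_{j=1}^{n-1} (θ^n b^{n-1}_{sj} - 3 a^{n-1}_{sj})  for n > 2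
phiFrom : (m : ℕ) → Vec ℤ (suc m) × Vec ℤ (suc m) → ℤ
phiFrom zero    _          = + 4
phiFrom (suc m) (as , bs) =
  + 4 * sumℤ (zipWith (λ a b → thetaFrom as * b - + 3 * a) as bs)

AB : (m : ℕ) → Vec ℤ (suc m) × Vec ℤ (suc m)
AB zero = (+ 1 ∷ []) , (+ 1 ∷ [])
AB (suc m) =
  (map (λ a → + 4 * a) (proj₁ (AB m)) ∷ʳ phiFrom m (AB m)) ,
  (map (λ b → (+ 1 + thetaFrom (proj₁ (AB m))) * b) (proj₂ (AB m)) ∷ʳ + 1)

-- φ^n for n ≥ 2 (values at n = 0, 1 are unused junk, set to 0).
phi : ℕ → ℤ
phi zero = + 0
phi (suc zero) = + 0
phi (suc (suc m)) = phiFrom m (AB m)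

{-# OPTIONS --safe #-}
-- Everything the recursion needs is carried by four numbers per level: the sums
-- A = Σⱼ aⱼ and B = Σⱼ bⱼ, the last entry L, and φ.  Since the vectors only grow
-- by scaling and appending, these obey a closed recursion, and eliminating L with
-- φ = 12 (L B − A) gives, one level later,
--   φ' − 3 φ² = 12 φ B + (36 φ − 48) A.
-- By induction A, B, L ≥ 0 and φ ≥ 4, so the right-hand side is nonnegative.
module Submission where

open import Defs
open import Data.Nat using (ℕ; zero; suc; _≤_; _∸_; z≤n; s≤s)
open import Data.Nat.Properties using (m≤m+n)
open import Data.Integer using (ℤ; 0ℤ; +_; _+_; _-_; _*_; +≤+) renaming (_≤_ to _≤ℤ_)
open import Data.Integer.Properties
  using (+-identityˡ; +-identityʳ; +-assoc; *-zeroʳ; *-distribˡ-+; pos-*; +-mono-≤; ≤-refl; ≤-trans;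
         i≤j⇒0≤j-i; 0≤i-j⇒j≤i)
open import Data.Integer.Tactic.RingSolver using (solve-∀)
open import Data.Vec using (Vec; []; _∷_; _∷ʳ_; map; zipWith; last)
open import Data.Vec.Properties using (last-∷ʳ)
open import Data.Product using (proj₁; proj₂)
open import Relation.Binary.PropositionalEquality using (_≡_; refl; sym; trans; cong; subst)

sumℤ-∷ʳ : ∀ {n} (xs : Vec ℤ n) x → sumℤ (xs ∷ʳ x) ≡ sumℤ xs + x
sumℤ-∷ʳ []       x = trans (+-identityʳ x) (sym (+-identityˡ x))
sumℤ-∷ʳ (y ∷ xs) x = trans (cong (_+_ y) (sumℤ-∷ʳ xs x)) (sym (+-assoc y (sumℤ xs) x))

sumℤ-map-* : ∀ {n} c (xs : Vec ℤ n) → sumℤ (map (c *_) xs) ≡ c * sumℤ xs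
sumℤ-map-* c []       = sym (*-zeroʳ c)
sumℤ-map-* c (y ∷ xs) =
  trans (cong (_+_ (c * y)) (sumℤ-map-* c xs)) (sym (*-distribˡ-+ c y (sumℤ xs)))

sumℤ-zipWith-linear : ∀ {n} t c (as bs : Vec ℤ n) →
  sumℤ (zipWith (λ a b → t * b - c * a) as bs) ≡ t * sumℤ bs - c * sumℤ as
sumℤ-zipWith-linear t c []       []       = nil t c
  where
  nil : ∀ t c → + 0 ≡ t * + 0 - c * + 0
  nil = solve-∀
sumℤ-zipWith-linear t c (a ∷ as) (b ∷ bs) =
  trans (cong (_+_ (t * b - c * a)) (sumℤ-zipWith-linear t c as bs))
        (cons t c a b (sumℤ as) (sumℤ bs))
  where
  cons : ∀ t c a b A B → (t * b - c * a) + (t * B - c * A) ≡ t * (b + B) - c * (a + A)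
  cons = solve-∀

-- Index shift: sumA k, sumB k, lastA k describe level n = k + 1, and φ k is φ^(k+2).
sumA sumB lastA φ : ℕ → ℤ
sumA k  = sumℤ (proj₁ (AB k))
sumB k  = sumℤ (proj₂ (AB k))
lastA k = last (proj₁ (AB k))
φ k     = phi (suc (suc k))

sumA-suc : ∀ k → sumA (suc k) ≡ + 4 * sumA k + φ k
sumA-suc k = trans (sumℤ-∷ʳ (map (+ 4 *_) as) (φ k)) (cong (_+ φ k) (sumℤ-map-* (+ 4) as))
  where as = proj₁ (AB k)

sumB-suc : ∀ k → sumB (suc k) ≡ (+ 1 + + 3 * lastA k) * sumB k + + 1
sumB-suc k = trans (sumℤ-∷ʳ (map (θ₁ *_) bs) (+ 1)) (cong (_+ + 1) (sumℤ-map-* θ₁ bs))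
  where
  θ₁ = + 1 + + 3 * lastA k
  bs = proj₂ (AB k)

lastA-suc : ∀ k → lastA (suc k) ≡ φ k
lastA-suc k = last-∷ʳ (φ k) (map (+ 4 *_) (proj₁ (AB k)))

φ-suc : ∀ k → φ (suc k) ≡ + 4 * (+ 3 * lastA (suc k) * sumB (suc k) - + 3 * sumA (suc k))
φ-suc k = cong (+ 4 *_) (sumℤ-zipWith-linear (+ 3 * lastA (suc k)) (+ 3) as bs)
  where
  as = proj₁ (AB (suc k))
  bs = proj₂ (AB (suc k))

-- φ' − 3 φ² with φ = 4 + e, so that all coefficients are nonnegative.
gap : ℤ → ℤ → ℤ → ℤ
gap e A B = + 12 * (e + + 4) * B + (+ 36 * e + + 96) * A

gap-identity : ∀ {φ₁} L₁ A₁ B₁ {φ₂ L₂ A₂ B₂} →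
  φ₁ ≡ + 4 * (+ 3 * L₁ * B₁ - + 3 * A₁) →
  L₂ ≡ φ₁ → B₂ ≡ (+ 1 + + 3 * L₁) * B₁ + + 1 → A₂ ≡ + 4 * A₁ + φ₁ →
  φ₂ ≡ + 4 * (+ 3 * L₂ * B₂ - + 3 * A₂) →
  φ₂ - + 3 * (φ₁ * φ₁) ≡ gap (φ₁ - + 4) A₁ B₁
gap-identity L₁ A₁ B₁ refl refl refl refl refl = polynomial L₁ A₁ B₁
  where
  polynomial : ∀ L A B → let φ₁ = + 4 * (+ 3 * L * B - + 3 * A) in
    + 4 * (+ 3 * φ₁ * ((+ 1 + + 3 * L) * B + + 1) - + 3 * (+ 4 * A + φ₁)) - + 3 * (φ₁ * φ₁)
      ≡ + 12 * ((φ₁ - + 4) + + 4) * B + (+ 36 * (φ₁ - + 4) + + 96) * A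
  polynomial = solve-∀

φ-gap : ∀ k → φ (suc (suc k)) - + 3 * (φ (suc k) * φ (suc k))
               ≡ gap (φ (suc k) - + 4) (sumA (suc k)) (sumB (suc k))
φ-gap k = gap-identity (lastA (suc k)) (sumA (suc k)) (sumB (suc k))
  (φ-suc k) (lastA-suc (suc k)) (sumB-suc (suc k)) (sumA-suc (suc k)) (φ-suc (suc k))

0≤+ : ∀ n → 0ℤ ≤ℤ + n
0≤+ _ = +≤+ z≤n

0≤i+j : ∀ {i j} → 0ℤ ≤ℤ i → 0ℤ ≤ℤ j → 0ℤ ≤ℤ i + j
0≤i+j = +-mono-≤

0≤i*j : ∀ {i j} → 0ℤ ≤ℤ i → 0ℤ ≤ℤ j → 0ℤ ≤ℤ i * j
0≤i*j {+ m} {+ n} _ _ rewrite sym (pos-* m n) = 0≤+ _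

0≤gap : ∀ {e A B} → 0ℤ ≤ℤ e → 0ℤ ≤ℤ A → 0ℤ ≤ℤ B → 0ℤ ≤ℤ gap e A B
0≤gap 0≤e 0≤A 0≤B =
  0≤i+j (0≤i*j (0≤i*j (0≤+ 12) (0≤i+j 0≤e (0≤+ 4))) 0≤B)
        (0≤i*j (0≤i+j (0≤i*j (0≤+ 36) 0≤e) (0≤+ 96)) 0≤A)

4≤3*x*x : ∀ {x} → + 4 ≤ℤ x → + 4 ≤ℤ + 3 * (x * x)
4≤3*x*x {x} 4≤x = 0≤i-j⇒j≤i (subst (0ℤ ≤ℤ_) (sym (expand x))
  (0≤i+j (0≤i+j (0≤i*j (0≤+ 3) (0≤i*j 0≤e 0≤e)) (0≤i*j (0≤+ 24) 0≤e)) (0≤+ 44)))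
  where
  0≤e : 0ℤ ≤ℤ x - + 4
  0≤e = i≤j⇒0≤j-i 4≤x
  expand : ∀ x → + 3 * (x * x) - + 4 ≡ + 3 * ((x - + 4) * (x - + 4)) + + 24 * (x - + 4) + + 44
  expand = solve-∀

record Bounds (k : ℕ) : Set where
  field
    0≤sumA  : 0ℤ ≤ℤ sumA k
    0≤sumB  : 0ℤ ≤ℤ sumB k
    0≤lastA : 0ℤ ≤ℤ lastA k
    4≤φ     : + 4 ≤ℤ φ k

φ-growth : ∀ k → Bounds k → + 3 * (φ k * φ k) ≤ℤ φ (suc k)
φ-growth zero    _ = +≤+ (m≤m+n 48 96)
φ-growth (suc k) b =
  0≤i-j⇒j≤i (subst (0ℤ ≤ℤ_) (sym (φ-gap k)) (0≤gap (i≤j⇒0≤j-i 4≤φ) 0≤sumA 0≤sumB))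
  where open Bounds b

bounds : ∀ k → Bounds k
bounds zero    = record { 0≤sumA = 0≤+ 1 ; 0≤sumB = 0≤+ 1 ; 0≤lastA = 0≤+ 1 ; 4≤φ = ≤-refl }
bounds (suc k) = record
  { 0≤sumA  = subst (0ℤ ≤ℤ_) (sym (sumA-suc k)) (0≤i+j (0≤i*j (0≤+ 4) 0≤sumA) 0≤φ)
  ; 0≤sumB  = subst (0ℤ ≤ℤ_) (sym (sumB-suc k))
                (0≤i+j (0≤i*j (0≤i+j (0≤+ 1) (0≤i*j (0≤+ 3) 0≤lastA)) 0≤sumB) (0≤+ 1))
  ; 0≤lastA = subst (0ℤ ≤ℤ_) (sym (lastA-suc k)) 0≤φ
  ; 4≤φ     = ≤-trans (4≤3*x*x 4≤φ) (φ-growth k b)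
  }
  where
  b = bounds k
  open Bounds b
  0≤φ : 0ℤ ≤ℤ φ k
  0≤φ = ≤-trans (0≤+ 4) 4≤φ

lemma1 : (n : ℕ) → 3 ≤ n → (+ 3 * (phi (n ∸ 1) * phi (n ∸ 1))) ≤ℤ phi n
lemma1 (suc (suc (suc k))) _               = φ-growth k (bounds k)
lemma1 (suc zero)          (s≤s ())
lemma1 (suc (suc zero))    (s≤s (s≤s ()))
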